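{- Let $r\ge 2$ and $\ell\ge 2$ be integers. Then there exists a positive integer $k$ such that $\ell^m+k$ is not $r$-full for every positive integer $m$.
   Context: A positive integer $n$ is called $r$-full if for every prime $p$, $p\mid n$ implies $p^r\mid n$. -}

module Defs where

open import Data.Nat using (ℕ; _^_)
open import Data.Nat.Divisibility using (_∣_)
open import Data.Nat.Primality using (Prime)

-- n is r-full: for every prime p, p ∣ n implies p ^ r ∣ n.
-- (Positivity of n is imposed separately where needed.)
RFull : ℕ → ℕ → Set
RFull r n = ∀ p → Prime p → p ∣ n → p ^ r ∣ n

{-# OPTIONS --safe #-}
module Submission where

-- Take a prime p ∣ ℓ and a k with p ∥ k (p divides k exactly once). For m ≥ 2,
-- p² ∣ ℓ^m, so p ∥ ℓ^m + k and ℓ^m + k is not r-full; it remains to make ℓ + k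
-- non-r-full as well. Writing ℓ = u p and k = p t, this holds when p ∤ t and
-- p ∤ u + t, which t ∈ {1, 2} achieves unless p = 2 ∥ ℓ. In that case either
-- ℓ = 2 (and k = 10 works: 3 ∥ 12) or ℓ has another prime factor q with q ≥ 3
-- or q² ∣ ℓ, which is used instead.

open import Defs
open import Data.Nat using (ℕ; zero; suc; _+_; _*_; _^_; _≤_; _<_; z≤n; s≤s; _≟_; nonTrivial⇒n>1)
open import Data.Nat.Properties
open import Data.Nat.Divisibility
open import Data.Nat.Primality
open import Data.Nat.Primality.Factorisation using (factorise)
open import Data.List using ([]; _∷_)
open import Data.Nat.ListAction using (product)
open import Data.List.Relation.Unary.All using (_∷_)
open import Data.Product using (∃-syntax; _×_; _,_)
open import Data.Sum using (_⊎_; inj₁; inj₂)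
open import Function using (_∘_)
open import Relation.Nullary using (¬_; yes; no; contradiction)
open import Relation.Nullary.Decidable using (from-yes; from-no)
open import Relation.Binary.PropositionalEquality using (_≡_; _≢_; refl; sym; cong; subst; module ≡-Reasoning)

prime>1 : ∀ {p} → Prime p → 1 < p
prime>1 {p} pp = nonTrivial⇒n>1 p {{prime⇒nonTrivial pp}}

prime∤1 : ∀ {p} → Prime p → p ∤ 1
prime∤1 pp = >⇒∤ (prime>1 pp)

prime≢2⇒≥3 : ∀ {p} → Prime p → p ≢ 2 → 3 ≤ p
prime≢2⇒≥3 pp p≢2 = ≤∧≢⇒< (prime>1 pp) (p≢2 ∘ sym)

∃-prime-divisor : ∀ {n} → 2 ≤ n → ∃[ p ] (Prime p × p ∣ n)
∃-prime-divisor {n@(suc _)} 2≤n with factorise n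
... | record { factors = [] ; isFactorisation = n≡1 } = contradiction n≡1 (>⇒≢ 2≤n)
... | record { factors = p ∷ ps ; isFactorisation = n≡Π ; factorsPrime = pp ∷ _ } =
  p , pp , subst (p ∣_) (sym n≡Π) (m∣m*n (product ps))

∃-good-prime-divisor : ∀ {ℓ} → 2 ≤ ℓ →
  ℓ ≡ 2 ⊎ ∃[ p ] (Prime p × p ∣ ℓ × (3 ≤ p ⊎ p * p ∣ ℓ))
∃-good-prime-divisor 2≤ℓ with ∃-prime-divisor 2≤ℓ
... | p , pp , p∣ℓ with p ≟ 2
... | no p≢2 = inj₂ (p , pp , p∣ℓ , inj₁ (prime≢2⇒≥3 pp p≢2))
... | yes refl with p∣ℓ
...   | divides 0 refl = contradiction 2≤ℓ λ ()
...   | divides 1 refl = inj₁ refl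
...   | divides u@(suc (suc _)) refl with ∃-prime-divisor {u} (s≤s (s≤s z≤n))
...     | q , qq , q∣u with q ≟ 2
...       | yes refl = inj₂ (2 , prime[2] , p∣ℓ , inj₂ (*-monoˡ-∣ 2 q∣u))
...       | no q≢2 = inj₂ (q , qq , ∣-trans q∣u (m∣m*n 2) , inj₁ (prime≢2⇒≥3 qq q≢2))

infix 4 _∥_

_∥_ : ℕ → ℕ → Set
p ∥ n = p ∣ n × p * p ∤ n

∥⇒>0 : ∀ {p n} → p ∥ n → 0 < n
∥⇒>0 {n = zero} (_ , pp∤0) = contradiction (_ ∣0) pp∤0
∥⇒>0 {n = suc _} _ = s≤s z≤n

∥⇒¬RFull : ∀ {r p n} → 2 ≤ r → Prime p → p ∥ n → ¬ RFull r n
∥⇒¬RFull {p = p} (s≤s (s≤s {n = r′} _)) pp (p∣n , pp∤n) rFull =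
  pp∤n (∣-trans (*-monoʳ-∣ p (m∣m*n (p ^ r′))) (rFull p pp p∣n))

∥-+ˡ : ∀ {p a b} → p * p ∣ a → p ∥ b → p ∥ a + b
∥-+ˡ {p} pp∣a (p∣b , pp∤b) =
  ∣m∣n⇒∣m+n (∣-trans (m∣m*n p) pp∣a) p∣b , λ pp∣a+b → pp∤b (∣m+n∣m⇒∣n pp∣a+b pp∣a)

∥-*ʳ : ∀ {p t} → Prime p → p ∤ t → p ∥ p * t
∥-*ʳ {p} {t} pp p∤t = m∣m*n t , p∤t ∘ *-cancelˡ-∣ p {{prime⇒nonZero pp}}

*∣^ : ∀ {p ℓ} m → p ∣ ℓ → p * p ∣ ℓ ^ (2 + m)
*∣^ m p∣ℓ = *-pres-∣ p∣ℓ (∣-trans p∣ℓ (m∣m*n _))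

¬RFull-^+ : ∀ {r p ℓ k} → 2 ≤ r → Prime p → p ∣ ℓ → p ∥ k → ¬ RFull r (ℓ + k) →
  ∀ m → 0 < m → ¬ RFull r (ℓ ^ m + k)
¬RFull-^+ {r} {ℓ = ℓ} {k} _ _ _ _ ¬rFull 1 _ =
  subst (λ n → ¬ RFull r (n + k)) (sym (^-identityʳ ℓ)) ¬rFull
¬RFull-^+ 2≤r pp p∣ℓ p∥k _ (suc (suc m)) _ = ∥⇒¬RFull 2≤r pp (∥-+ˡ (*∣^ m p∣ℓ) p∥k)

∃-avoiding-shift : ∀ {p u} → Prime p → 3 ≤ p ⊎ p ∣ u → ∃[ t ] (p ∤ t × p ∤ u + t)
∃-avoiding-shift pp (inj₂ p∣u) = 1 , prime∤1 pp , λ p∣u+1 → prime∤1 pp (∣m+n∣m⇒∣n p∣u+1 p∣u)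
∃-avoiding-shift {p} {u} pp (inj₁ 3≤p) with p ∣? u + 1
... | no p∤u+1 = 1 , prime∤1 pp , p∤u+1
... | yes p∣u+1 = 2 , >⇒∤ 3≤p , λ p∣u+2 →
  prime∤1 pp (∣m+n∣m⇒∣n (subst (p ∣_) (sym (+-assoc u 1 1)) p∣u+2) p∣u+1)

∃-exact-shift : ∀ {p ℓ} → Prime p → p ∣ ℓ → 3 ≤ p ⊎ p * p ∣ ℓ → ∃[ k ] (p ∥ k × p ∥ ℓ + k)
∃-exact-shift {p} pp (divides u refl) good with ∃-avoiding-shift {u = u} pp (p∣u good)
  where
  p∣u : 3 ≤ p ⊎ p * p ∣ u * p → 3 ≤ p ⊎ p ∣ u
  p∣u (inj₁ 3≤p) = inj₁ 3≤p
  p∣u (inj₂ pp∣up) = inj₂ (*-cancelʳ-∣ p {{prime⇒nonZero pp}} pp∣up)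
... | t , p∤t , p∤u+t = p * t , ∥-*ʳ pp p∤t , subst (p ∥_) (sym up+pt≡p[u+t]) (∥-*ʳ pp p∤u+t)
  where
  up+pt≡p[u+t] : u * p + p * t ≡ p * (u + t)
  up+pt≡p[u+t] = begin
    u * p + p * t ≡⟨ cong (_+ p * t) (*-comm u p) ⟩
    p * u + p * t ≡⟨ *-distribˡ-+ p u t ⟨
    p * (u + t)   ∎
    where open ≡-Reasoning

theorem1p1 : ∀ (r ℓ : ℕ) → 2 ≤ r → 2 ≤ ℓ →
    ∃[ k ] (0 < k × (∀ (m : ℕ) → 0 < m → ¬ RFull r (ℓ ^ m + k)))
theorem1p1 r ℓ 2≤r 2≤ℓ with ∃-good-prime-divisor 2≤ℓ
... | inj₁ refl = 10 , ∥⇒>0 2∥10 , ¬RFull-^+ 2≤r prime[2] ∣-refl 2∥10 (∥⇒¬RFull 2≤r 3-prime 3∥12)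
  where
  2∥10 : 2 ∥ 10
  2∥10 = divides 5 refl , from-no (4 ∣? 10)
  3∥12 : 3 ∥ 12
  3∥12 = divides 4 refl , from-no (9 ∣? 12)
  3-prime : Prime 3
  3-prime = from-yes (prime? 3)
... | inj₂ (p , pp , p∣ℓ , good) with ∃-exact-shift pp p∣ℓ good
... | k , p∥k , p∥ℓ+k = k , ∥⇒>0 p∥k , ¬RFull-^+ 2≤r pp p∣ℓ p∥k (∥⇒¬RFull 2≤r pp p∥ℓ+k)
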